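{- Let $V\ge 1$ and $d\ge 0$ be integers, and let $s:\{0,1,\dots,V-1\}\to\mathbb{Z}$ be a weakly increasing function. (Geometrically, $s$ describes a staircase lattice path $S$ in the plane consisting of unit north steps from $(s(y),y)$ to $(s(y),y+1)$ for $y=0,\dots,V-1$, joined by east steps, running inside the horizontal strip $0\le Y\le V$ from the bottom line $Y=0$ to the top line $Y=V$; a cell is a unit square $[x,x+1]\times[y,y+1]$ with $x,y\in\mathbb{Z}$.) Define the broken column at distance $d$ to the left of $S$ as the set $C_l$ of cells $c_y^{l}=[s(y)-d-1,\,s(y)-d]\times[y,y+1]$, $0\le y\le V-1$ (the cells in row $y$ with exactly $d$ cells strictly between them and $S$), and the broken column at distance $d$ to the right of $S$ as the set $C_r$ of cells $c_y^{r}=[s(y)+d,\,s(y)+d+1]\times[y,y+1]$, $0\le y\le V-1$. For a cell $c=[x,x+1]\times[y,y+1]\in C_l$ let $$l(c)=\#\{y' : 0\le y'<y,\ s(y')\ge x+1\},$$ the number of cells directly below $c$ in its column lying to the left of $S$ and above the bottom line $Y=0$; for a cell $c=[x,x+1]\times[y,y+1]\in C_r$ let $$l'(c)=\#\{y' : y<y'\le V-1,\ s(y')\le x\},$$ the number of cells directly above $c$ in its column lying to the right of $S$ and below the top line $Y=V$. Then there is an explicit bijection between the multisets $\{l(c):c\in C_l\}$ and $\{l'(c):c\in C_r\}$; in particular these two multisets (each of cardinality $V$) are equal.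
   Context: This lemma is used to compare multisets of hook pairs (arm length, leg length) of cells of skew diagrams: the arm length of a cell is the number of cells strictly to its right in its row within the region, and the leg length the number of cells strictly below it in its column within the region. In the lemma, the cells of $C_l$ are exactly those of the region to the left of $S$ (inside the strip) having arm length $d$ measured up to $S$, and similarly for $C_r$ with the region to the right of $S$ rotated by $180^\circ$. Since $s$ is weakly increasing, the cells counted in $l(c)$ (resp. $l'(c)$) form a contiguous block directly below (resp. above) $c$. -}

module Defs where

open import Data.Nat using (ℕ; suc)
open import Data.Integer using (ℤ; _+_; _-_; _≤_; +_)
open import Data.Integer.Properties using (_≤?_)
open import Data.Fin using (Fin; toℕ)
open import Data.Fin.Properties as FinP using ()
open import Data.List using (List; map; filter; length; allFin)
open import Relation.Nullary.Decidable using (_×-dec_)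
open import Data.Product using (_×_)

-- A staircase path S in the strip 0 ≤ Y ≤ V is given by s : Fin V → ℤ,
-- s y being the x-coordinate of the north step in row y.
WeaklyIncreasing : ∀ {V} → (Fin V → ℤ) → Set
WeaklyIncreasing {V} s = ∀ (i j : Fin V) → toℕ i Data.Nat.≤ toℕ j → s i ≤ s j

xLeft : ∀ {V} → (Fin V → ℤ) → ℕ → Fin V → ℤ
xLeft s d y = s y - + d - + 1

xRight : ∀ {V} → (Fin V → ℤ) → ℕ → Fin V → ℤ
xRight s d y = s y + + d

lLen : ∀ {V} → (Fin V → ℤ) → ℤ → Fin V → ℕ
lLen {V} s x y =
  length (filter (λ y' → (suc (toℕ y') Data.Nat.≤? toℕ y) ×-dec (x + + 1 ≤? s y')) (allFin V))

l'Len : ∀ {V} → (Fin V → ℤ) → ℤ → Fin V → ℕ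
l'Len {V} s x y =
  length (filter (λ y' → (suc (toℕ y) Data.Nat.≤? toℕ y') ×-dec (s y' ≤? x)) (allFin V))

leftMultiset : ∀ {V} → (Fin V → ℤ) → ℕ → List ℕ
leftMultiset {V} s d = map (λ y → lLen s (xLeft s d y) y) (allFin V)

rightMultiset : ∀ {V} → (Fin V → ℤ) → ℕ → List ℕ
rightMultiset {V} s d = map (λ y → l'Len s (xRight s d y) y) (allFin V)

{-# OPTIONS --safe #-}
module Submission where

-- Call rows a < b related when s b ≤ s a + d. Row a lies under c^l_b inside the region left
-- of S exactly when a is related to b, and row b lies over c^r_a inside the region right of S
-- exactly when a is related to b; so l lists the in-degrees and l' the out-degrees of this
-- relation. As s is weakly increasing, the relation survives moving a up or b down. For such a
-- relation the rows related to row 0 are an initial segment 1, …, m, each related to every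
-- earlier row, so deleting row 0 turns their in-degrees 1, …, m into 0, …, m - 1 while the
-- in-degree 0 of row 0 is traded for its out-degree m; induction on the number of rows.

open import Defs
open import Data.Bool.Base using (true; false; if_then_else_)
open import Data.Empty using (⊥-elim)
open import Data.Fin.Base as Fin using (Fin; zero; suc; toℕ)
open import Data.Fin.Properties using (_<?_)
open import Data.Integer.Base as ℤ using (ℤ)
import Data.Integer.Properties as ℤ
open import Algebra.Properties.AbelianGroup ℤ.+-0-abelianGroup using (//-rightDividesˡ; //-rightDividesʳ)
open import Data.List.Base using ([]; _∷_; filter; length; tabulate)
open import Data.List.Properties using (map-tabulate; tabulate-cong)
open import Data.List.Relation.Binary.Permutation.Propositional
  using (_↭_; ↭-refl; ↭-reflexive; ↭-prep; ↭-swap; module PermutationReasoning)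
open import Data.Nat.Base using (ℕ; zero; suc; _+_; _≥_; z≤n; s≤s)
open import Data.Nat.Properties using (+-suc; +-identityʳ)
open import Data.Product.Base using (_,_; proj₁)
open import Data.Product.Function.NonDependent.Propositional using (_×-⇔_)
open import Function.Base using (_∘_; id)
open import Function.Bundles using (_⇔_; mk⇔)
open import Function.Properties.Equivalence using () renaming (refl to ⇔-refl)
open import Level using (0ℓ)
open import Relation.Binary.Core using (Rel)
open import Relation.Binary.Definitions using (Decidable; _Respects_; _Respectsˡ_; _Respectsʳ_)
open import Relation.Binary.PropositionalEquality using (_≡_; refl; sym; trans; cong; cong₂; subst)
open import Relation.Nullary using (yes; no; does; ¬_)
open import Relation.Nullary.Decidable using (_×-dec_; does-⇔)
import Relation.Unary as U

open PermutationReasoning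

count : ∀ {n} {P : U.Pred (Fin n) 0ℓ} → U.Decidable P → ℕ
count {zero}  P? = 0
count {suc n} P? = if does (P? zero) then suc (count (P? ∘ suc)) else count (P? ∘ suc)

count-cong : ∀ {n} {P Q : U.Pred (Fin n) 0ℓ} (P? : U.Decidable P) (Q? : U.Decidable Q) →
             (∀ i → does (P? i) ≡ does (Q? i)) → count P? ≡ count Q?
count-cong {zero}  P? Q? eq = refl
count-cong {suc n} P? Q? eq rewrite eq zero
  with does (Q? zero) | count-cong (P? ∘ suc) (Q? ∘ suc) (eq ∘ suc)
... | true  | ih = cong suc ih
... | false | ih = ih

count-none : ∀ {n} {P : U.Pred (Fin n) 0ℓ} (P? : U.Decidable P) → (∀ i → ¬ P i) → count P? ≡ 0
count-none {zero}  P? ¬P = refl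
count-none {suc n} P? ¬P with P? zero
... | yes p = ⊥-elim (¬P zero p)
... | no _  = count-none (P? ∘ suc) (¬P ∘ suc)

count-<? : ∀ {n} (b : Fin n) → count {n} (_<? b) ≡ toℕ b
count-<? {suc n} zero    = count-none (λ (a : Fin n) → suc a <? zero {n}) (λ _ ())
count-<? {suc n} (suc b) =
  cong suc (trans (count-cong (λ a → suc a <? suc b) (λ (a : Fin n) → a <? b) (λ _ → refl))
                  (count-<? b))

length-filter-tabulate : ∀ {A : Set} {P : U.Pred A 0ℓ} (P? : U.Decidable P) {n} (g : Fin n → A) →
                         length (filter P? (tabulate g)) ≡ count (P? ∘ g)
length-filter-tabulate P? {zero}  g = refl
length-filter-tabulate P? {suc n} g with does (P? (g zero))
... | true  = cong suc (length-filter-tabulate P? (g ∘ suc))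
... | false = length-filter-tabulate P? (g ∘ suc)

incrementWhere : ∀ {n} {P : U.Pred (Fin n) 0ℓ} → U.Decidable P → (Fin n → ℕ) → Fin n → ℕ
incrementWhere P? f b = if does (P? b) then suc (f b) else f b

-- On the prefix where P holds f counts up from k, so both sides are k, k + 1, …, k + count P?
-- (rotated on the right) followed by the values of f beyond the prefix.
rotate-prefix : ∀ {n} {P : U.Pred (Fin n) 0ℓ} (P? : U.Decidable P) (f : Fin n → ℕ) k →
                P Respects Fin._≥_ → (∀ {b} → P b → f b ≡ k + toℕ b) →
                k ∷ tabulate (incrementWhere P? f) ↭ k + count P? ∷ tabulate f
rotate-prefix {zero}  P? f k down f≡ = ↭-reflexive (cong (_∷ []) (sym (+-identityʳ k)))
rotate-prefix {suc n} {P} P? f k down f≡ with P? zero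
... | yes p = begin
  k ∷ suc (f zero) ∷ tabulate (incrementWhere (P? ∘ suc) (f ∘ suc))
    ≡⟨ cong (λ m → k ∷ suc m ∷ tabulate (incrementWhere (P? ∘ suc) (f ∘ suc))) f0≡k ⟩
  k ∷ suc k ∷ tabulate (incrementWhere (P? ∘ suc) (f ∘ suc))
    ↭⟨ ↭-prep k (rotate-prefix (P? ∘ suc) (f ∘ suc) (suc k) (down ∘ s≤s) f≡k+1+b) ⟩
  k ∷ suc k + count (P? ∘ suc) ∷ tabulate (f ∘ suc)
    ↭⟨ ↭-swap _ _ ↭-refl ⟩
  suc k + count (P? ∘ suc) ∷ k ∷ tabulate (f ∘ suc)
    ≡⟨ cong₂ (λ m o → m ∷ o ∷ tabulate (f ∘ suc)) (sym (+-suc k _)) (sym f0≡k) ⟩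
  k + suc (count (P? ∘ suc)) ∷ f zero ∷ tabulate (f ∘ suc) ∎
  where
  f0≡k : f zero ≡ k
  f0≡k = trans (f≡ p) (+-identityʳ k)
  f≡k+1+b : ∀ {b} → P (suc b) → f (suc b) ≡ suc k + toℕ b
  f≡k+1+b {b} pb = trans (f≡ pb) (+-suc k (toℕ b))
... | no ¬p = begin
  k ∷ f zero ∷ tabulate (incrementWhere (P? ∘ suc) (f ∘ suc))
    ↭⟨ ↭-swap _ _ ↭-refl ⟩
  f zero ∷ k ∷ tabulate (incrementWhere (P? ∘ suc) (f ∘ suc))
    ↭⟨ ↭-prep (f zero)
         (rotate-prefix (P? ∘ suc) (f ∘ suc) k (down ∘ s≤s) (⊥-elim ∘ ¬p ∘ down z≤n)) ⟩
  f zero ∷ k + count (P? ∘ suc) ∷ tabulate (f ∘ suc)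
    ↭⟨ ↭-swap _ _ ↭-refl ⟩
  k + count (P? ∘ suc) ∷ f zero ∷ tabulate (f ∘ suc) ∎

module _ {n} {R : Rel (Fin n) 0ℓ} (R? : Decidable R) where

  indegree : Fin n → ℕ
  indegree b = count (λ a → a <? b ×-dec R? a b)

  outdegree : Fin n → ℕ
  outdegree a = count (λ b → a <? b ×-dec R? a b)

indegrees↭outdegrees : ∀ {n} {R : Rel (Fin n) 0ℓ} (R? : Decidable R) →
                       R Respectsˡ Fin._≤_ → R Respectsʳ Fin._≥_ →
                       tabulate (indegree R?) ↭ tabulate (outdegree R?)
indegrees↭outdegrees {zero}  R? closedˡ closedʳ = ↭-refl
indegrees↭outdegrees {suc n} {R} R? closedˡ closedʳ = begin
  indegree R? zero ∷ tabulate (indegree R? ∘ suc)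
    ≡⟨ cong₂ _∷_ indegree-zero (tabulate-cong indegree-suc) ⟩
  0 ∷ tabulate (incrementWhere χ? (indegree R⁺?))
    ↭⟨ rotate-prefix χ? (indegree R⁺?) 0 (closedʳ ∘ s≤s) indegree-full ⟩
  count χ? ∷ tabulate (indegree R⁺?)
    ↭⟨ ↭-prep (count χ?) (indegrees↭outdegrees R⁺? (closedˡ ∘ s≤s) (closedʳ ∘ s≤s)) ⟩
  count χ? ∷ tabulate (outdegree R⁺?)
    ≡⟨ sym (cong₂ _∷_ outdegree-zero (tabulate-cong outdegree-suc)) ⟩
  outdegree R? zero ∷ tabulate (outdegree R? ∘ suc) ∎
  where
  R⁺? : Decidable (λ a b → R (suc a) (suc b))
  R⁺? a b = R? (suc a) (suc b)
  χ? : U.Decidable (λ b → R zero (suc b))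
  χ? b = R? zero (suc b)

  indegree-zero : indegree R? zero ≡ 0
  indegree-zero = count-none {n} _ (λ _ ())

  indegree-suc : ∀ b → indegree R? (suc b) ≡ incrementWhere χ? (indegree R⁺?) b
  indegree-suc b = cong (λ m → if does (χ? b) then suc m else m) (count-cong {n} _ _ (λ _ → refl))

  indegree-full : ∀ {b} → R zero (suc b) → indegree R⁺? b ≡ toℕ b
  indegree-full {b} r = trans (count-cong {n} _ (_<? b) every-a<b) (count-<? b)
    where
    every-a<b : ∀ a → does (a <? b ×-dec R⁺? a b) ≡ does (a <? b)
    every-a<b a =
      does-⇔ (mk⇔ proj₁ (λ a<b → a<b , closedˡ z≤n r)) (a <? b ×-dec R⁺? a b) (a <? b)

  outdegree-zero : outdegree R? zero ≡ count χ?
  outdegree-zero = count-cong {n} _ _ (λ _ → refl)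

  outdegree-suc : ∀ a → outdegree R? (suc a) ≡ outdegree R⁺? a
  outdegree-suc a = count-cong {n} _ _ (λ _ → refl)

i-j≤k⇔i≤k+j : ∀ i j k → i ℤ.- j ℤ.≤ k ⇔ i ℤ.≤ k ℤ.+ j
i-j≤k⇔i≤k+j i j k = mk⇔
  (λ h → subst (ℤ._≤ k ℤ.+ j) (//-rightDividesˡ j i) (ℤ.+-monoˡ-≤ j h))
  (λ h → subst (i ℤ.- j ℤ.≤_) (//-rightDividesʳ j k) (ℤ.+-monoˡ-≤ (ℤ.- j) h))

ShiftAtMost : ∀ {V} → (Fin V → ℤ) → ℕ → Rel (Fin V) 0ℓ
ShiftAtMost s d a b = s b ℤ.≤ s a ℤ.+ ℤ.+ d

shiftAtMost? : ∀ {V} (s : Fin V → ℤ) d → Decidable (ShiftAtMost s d)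
shiftAtMost? s d a b = s b ℤ.≤? s a ℤ.+ ℤ.+ d

module _ {V} {s : Fin V → ℤ} (s-mono : WeaklyIncreasing s) (d : ℕ) where

  shiftAtMost-respectsˡ : ShiftAtMost s d Respectsˡ Fin._≤_
  shiftAtMost-respectsˡ a≤a' h = ℤ.≤-trans h (ℤ.+-monoˡ-≤ (ℤ.+ d) (s-mono _ _ a≤a'))

  shiftAtMost-respectsʳ : ShiftAtMost s d Respectsʳ Fin._≥_
  shiftAtMost-respectsʳ b'≤b h = ℤ.≤-trans (s-mono _ _ b'≤b) h

xLeft+1≤⇔shiftAtMost : ∀ {V} (s : Fin V → ℤ) d a y →
                       xLeft s d y ℤ.+ ℤ.1ℤ ℤ.≤ s a ⇔ ShiftAtMost s d a y
xLeft+1≤⇔shiftAtMost s d a y =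
  subst (λ t → t ℤ.≤ s a ⇔ ShiftAtMost s d a y)
        (sym (//-rightDividesˡ ℤ.1ℤ (s y ℤ.- ℤ.+ d)))
        (i-j≤k⇔i≤k+j (s y) (ℤ.+ d) (s a))

leftMultiset≡indegrees : ∀ {V} (s : Fin V → ℤ) d →
                         leftMultiset s d ≡ tabulate (indegree (shiftAtMost? s d))
leftMultiset≡indegrees {V} s d = trans (map-tabulate id _) (tabulate-cong lLen≡indegree)
  where
  lLen≡indegree : ∀ y → lLen s (xLeft s d y) y ≡ indegree (shiftAtMost? s d) y
  lLen≡indegree y = trans (length-filter-tabulate _ {V} id) (count-cong {V} _ _ λ a →
    does-⇔ (⇔-refl ×-⇔ xLeft+1≤⇔shiftAtMost s d a y)
           (a <? y ×-dec xLeft s d y ℤ.+ ℤ.1ℤ ℤ.≤? s a) (a <? y ×-dec shiftAtMost? s d a y))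

rightMultiset≡outdegrees : ∀ {V} (s : Fin V → ℤ) d →
                           rightMultiset s d ≡ tabulate (outdegree (shiftAtMost? s d))
rightMultiset≡outdegrees {V} s d =
  trans (map-tabulate id _) (tabulate-cong λ y → length-filter-tabulate _ {V} id)

mainTheorem1 : (V : ℕ) → V ≥ 1 → (d : ℕ) → (s : Fin V → ℤ) → WeaklyIncreasing s →
               leftMultiset s d ↭ rightMultiset s d
mainTheorem1 V _ d s s-mono = begin
  leftMultiset s d
    ≡⟨ leftMultiset≡indegrees s d ⟩
  tabulate (indegree (shiftAtMost? s d))
    ↭⟨ indegrees↭outdegrees (shiftAtMost? s d)
         (shiftAtMost-respectsˡ s-mono d) (shiftAtMost-respectsʳ s-mono d) ⟩
  tabulate (outdegree (shiftAtMost? s d))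
    ≡⟨ rightMultiset≡outdegrees s d ⟨
  rightMultiset s d ∎
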